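{- Let $G$ be an $\{\mathrm{ISK4},\mathrm{wheel}\}$-free trigraph whose full realization contains a prism as an induced subgraph. Then $G$ contains a prism as an induced subtrigraph.
   Context: A trigraph $G$ is a finite set $V(G)$ with a function $\theta_G$ from 2-element subsets to $\{ -1,0,1\}$; $uv$ is strongly adjacent if $\theta_G(uv)=1$, semi-adjacent if $0$, strongly anti-adjacent if $-1$, adjacent if $\ge0$. A graph is a trigraph with no semi-adjacent pairs. A realization is a graph obtained by turning each semi-adjacent pair into an edge or non-edge; the full realization makes them all edges. $G$ is $\{\mathrm{ISK4},\mathrm{wheel}\}$-free if no realization contains an induced subgraph isomorphic to a subdivision of $K_4$ or to a wheel (a chordless cycle plus a vertex with at least three neighbors on it). Induced subtrigraphs restrict $\theta_G$. Degree = number of neighbors; branch vertex = degree at least three. A narrow path is a trigraph whose full realization is a path. A triangle is three pairwise adjacent vertices, strong if pairwise strongly adjacent. A branch of a trigraph $K$ is a narrow path in $K$ between two distinct branch vertices with no interior branch vertex; flat if no adjacent pair of it lies in a triangle of $K$. A prism is a trigraph $K$ consisting of two vertex-disjoint strong triangles $\{x,y,z\}$, $\{x',y',z'\}$ and $(x,x')$-, $(y,y')$-, $(z,z')$-flat branches $P_x,P_y,P_z$ of $K$ such that $xy$ and $x'y'$ are the only adjacent pairs between $V(P_x)$ and $V(P_y)$, and similarly for the other two pairs (for graphs, this is the usual prism: two vertex-disjoint triangles joined by three vertex-disjoint paths with no other edges). -}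

module Defs where

open import Data.Nat using (ℕ; zero; suc; _≤_; _≡ᵇ_)
open import Data.Bool using (Bool; true; false; _∧_; _∨_; not)
open import Data.Fin using (Fin; zero; suc; toℕ; fromℕ; _≟_)
open import Data.Fin.Subset using (Subset; ∣_∣)
open import Data.Vec using (lookup)
open import Data.Product using (Σ; _×_; ∃)
open import Data.Sum using (_⊎_)
open import Data.Empty using (⊥)
open import Relation.Nullary using (¬_; ⌊_⌋)
open import Relation.Binary.PropositionalEquality using (_≡_; _≢_; cong)
open import Function.Definitions using (Injective)

-- values of θ : -1 (neg), 0 (zer), 1 (pos)
data Sign : Set where
  neg zer pos : Sign

-- θ is only meaningful on pairs of distinct vertices (2-element subsets);
-- its value on the diagonal is ignored everywhere below.
record Trigraph (n : ℕ) : Set where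
  field
    θ   : Fin n → Fin n → Sign
    sym : ∀ u v → θ u v ≡ θ v u
open Trigraph public

Adj : ∀ {n} → Trigraph n → Fin n → Fin n → Set
Adj G u v = (u ≢ v) × (θ G u v ≢ neg)

Strong : ∀ {n} → Trigraph n → Fin n → Fin n → Set
Strong G u v = (u ≢ v) × (θ G u v ≡ pos)

-- Graphs (simple graphs are given by a Bool-valued adjacency; for
-- realizations we additionally require symmetry and irreflexivity)

Graph : ℕ → Set
Graph n = Fin n → Fin n → Bool

IsRealization : ∀ {n} → Trigraph n → Graph n → Set
IsRealization {n} G R =
  (∀ u → R u u ≡ false) ×
  (∀ u v → R u v ≡ R v u) ×
  (∀ u v → u ≢ v → (θ G u v ≡ pos → R u v ≡ true) × (θ G u v ≡ neg → R u v ≡ false))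

Embeds : ∀ {m n} → Graph m → Graph n → Set
Embeds {m} {n} H R =
  Σ (Fin m → Fin n) λ f → Injective _≡_ _≡_ f × (∀ i j → H i j ≡ R (f i) (f j))

K4 : Graph 4
K4 i j = not ⌊ i ≟ j ⌋

-- subdivide the edge uv of H by a new vertex (the new vertex is zero,
-- the old vertex i becomes suc i)
subdivide : ∀ {m} → Graph m → Fin m → Fin m → Graph (suc m)
subdivide H u v zero    zero    = false
subdivide H u v zero    (suc j) = ⌊ j ≟ u ⌋ ∨ ⌊ j ≟ v ⌋
subdivide H u v (suc i) zero    = ⌊ i ≟ u ⌋ ∨ ⌊ i ≟ v ⌋
subdivide H u v (suc i) (suc j) =
  H i j ∧ not ((⌊ i ≟ u ⌋ ∧ ⌊ j ≟ v ⌋) ∨ (⌊ i ≟ v ⌋ ∧ ⌊ j ≟ u ⌋))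

-- the subdivisions of K4 (up to relabelling of vertices, which is
-- absorbed by Embeds)
data SubdivK4 : ∀ {m} → Graph m → Set where
  base : SubdivK4 K4
  step : ∀ {m} {H : Graph m} → SubdivK4 H →
         (u v : Fin m) → H u v ≡ true → SubdivK4 (subdivide H u v)

-- Wheels: a chordless cycle on k ≥ 3 vertices (vertices suc i, i : Fin k,
-- i adjacent to i+1 mod k) plus a centre (vertex zero) whose set of
-- neighbours on the cycle is S, with |S| ≥ 3.

cycleAdj : (k : ℕ) → Fin k → Fin k → Bool
cycleAdj k i j =
  (suc (toℕ i) ≡ᵇ toℕ j) ∨ (suc (toℕ j) ≡ᵇ toℕ i) ∨
  ((toℕ i ≡ᵇ 0) ∧ (suc (toℕ j) ≡ᵇ k)) ∨ ((toℕ j ≡ᵇ 0) ∧ (suc (toℕ i) ≡ᵇ k))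

wheel : (k : ℕ) → Subset k → Graph (suc k)
wheel k S zero    zero    = false
wheel k S zero    (suc j) = lookup S j
wheel k S (suc i) zero    = lookup S i
wheel k S (suc i) (suc j) = cycleAdj k i j

ISK4Free : ∀ {n} → Trigraph n → Set
ISK4Free {n} G = ∀ (R : Graph n) → IsRealization G R →
  ∀ {m} (H : Graph m) → SubdivK4 H → ¬ Embeds H R

WheelFree : ∀ {n} → Trigraph n → Set
WheelFree {n} G = ∀ (R : Graph n) → IsRealization G R →
  ∀ (k : ℕ) (S : Subset k) → 3 ≤ k → 3 ≤ ∣ S ∣ → ¬ Embeds (wheel k S) R

-- Full realization, viewed as a trigraph with no semi-adjacent pair

collapse : Sign → Sign
collapse neg = neg
collapse zer = pos
collapse pos = pos

fullRealization : ∀ {n} → Trigraph n → Trigraph n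
fullRealization G = record
  { θ   = λ u v → collapse (θ G u v)
  ; sym = λ u v → cong collapse (sym G u v) }

Consec : ∀ {a} → Fin a → Fin a → Set
Consec i j = (suc (toℕ i) ≡ toℕ j) ⊎ (suc (toℕ j) ≡ toℕ i)

OnPath : ∀ {n a} → (Fin a → Fin n) → Fin n → Set
OnPath p v = ∃ λ i → v ≡ p i

-- a narrow path in G, listed in order: the full realization of the
-- induced subtrigraph on its vertices is the path p 0 - p 1 - ... - p a
NarrowPath : ∀ {n a} → Trigraph n → (Fin (suc a) → Fin n) → Set
NarrowPath G p = Injective _≡_ _≡_ p ×
  (∀ i j → (Adj G (p i) (p j) → Consec i j) × (Consec i j → Adj G (p i) (p j)))

Disjoint : ∀ {n a b} → (Fin a → Fin n) → (Fin b → Fin n) → Set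
Disjoint p q = ∀ i j → p i ≢ q j

OnlyEnds : ∀ {n a b} → Trigraph n → (Fin (suc a) → Fin n) → (Fin (suc b) → Fin n) → Set
OnlyEnds {n} {a} {b} G p q = ∀ i j → Adj G (p i) (q j) →
  ((toℕ i ≡ 0) × (toℕ j ≡ 0)) ⊎ ((toℕ i ≡ a) × (toℕ j ≡ b))

BranchIn : ∀ {n} → Trigraph n → (Fin n → Set) → Fin n → Set
BranchIn G K v = ∃ λ u₁ → ∃ λ u₂ → ∃ λ u₃ →
  K u₁ × K u₂ × K u₃ × (u₁ ≢ u₂) × (u₁ ≢ u₃) × (u₂ ≢ u₃) ×
  Adj G v u₁ × Adj G v u₂ × Adj G v u₃

FlatBranch : ∀ {n a} → Trigraph n → (Fin n → Set) → (Fin (suc a) → Fin n) → Set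
FlatBranch {n} {a} G K p =
  NarrowPath G p ×
  (p zero ≢ p (fromℕ a)) ×
  BranchIn G K (p zero) × BranchIn G K (p (fromℕ a)) ×
  (∀ i → toℕ i ≢ 0 → toℕ i ≢ a → ¬ BranchIn G K (p i)) ×
  (∀ i j w → K w → Adj G (p i) (p j) → Adj G (p i) w → Adj G (p j) w → ⊥)

record HasPrism {n} (G : Trigraph n) : Set where
  field
    a b c : ℕ
    px : Fin (suc a) → Fin n
    py : Fin (suc b) → Fin n
    pz : Fin (suc c) → Fin n
  K : Fin n → Set
  K v = OnPath px v ⊎ OnPath py v ⊎ OnPath pz v
  x  = px zero
  y  = py zero
  z  = pz zero
  x' = px (fromℕ a)
  y' = py (fromℕ b)
  z' = pz (fromℕ c)
  field
    triangles-disjoint :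
      (x ≢ x') × (x ≢ y') × (x ≢ z') × (y ≢ x') × (y ≢ y') × (y ≢ z') ×
      (z ≢ x') × (z ≢ y') × (z ≢ z')
    strong₁ : Strong G x y × Strong G y z × Strong G x z
    strong₂ : Strong G x' y' × Strong G y' z' × Strong G x' z'
    disjoint : Disjoint px py × Disjoint px pz × Disjoint py pz
    flat-x : FlatBranch G K px
    flat-y : FlatBranch G K py
    flat-z : FlatBranch G K pz
    ends-xy : OnlyEnds G px py
    ends-xz : OnlyEnds G px pz
    ends-yz : OnlyEnds G py pz

module Submission where

-- Adjacency in G and in its full
-- realization coincide, so the branches of the prism and the conditions on
-- them carry over to G unchanged; what has to be shown is that the six pairs
-- of the two triangles are strongly adjacent in G, i.e. not semi-adjacent.
--
-- If a triangle pair, say x y, were semi-adjacent, take the realization R of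
-- G in which x y is the only dropped adjacent pair.  In R the prism minus the
-- edge x y is an induced subdivision of K4 with branch vertices z, x', y', z'.
-- It is built from the K4 on these vertices, living in R plus the three
-- "virtual" edges z x', z y', z z', by replacing each virtual edge by the
-- corresponding path of the prism, one subdivision step per interior vertex.

open import Data.Nat using (ℕ; zero; suc; _≤_; z≤n; s≤s; _∸_; _+_)
open import Data.Nat.Properties
  using (≤-refl; ≤-trans; ≤-antisym; n≤1+n; m≤n⇒m≤1+n; 1+n≰n; m∸n≤m; n∸n≡0;
         m∸n≡0⇒m≤n; ∸-cancelˡ-≡; m∸n+n≡m; +-cancelˡ-≡; +-suc; +-∸-assoc; 0≢1+n)
open import Data.Bool using (Bool; true; false; _∧_; _∨_; not)
open import Data.Bool.Properties using (∨-identityʳ; ∨-zeroʳ; ∧-zeroʳ; ∧-identityʳ; ∨-comm; ∧-comm)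
open import Data.Fin using (Fin; zero; suc; toℕ; fromℕ; fromℕ<; _≟_)
open import Data.Fin.Properties using (toℕ-fromℕ; toℕ-fromℕ<)
open import Data.Vec.Functional using (_∷_; [])
open import Data.Product using (Σ; _×_; ∃; _,_; proj₁; proj₂; swap)
open import Data.Sum using (_⊎_; inj₁; inj₂) renaming (map to ⊎-map)
open import Data.Empty using (⊥; ⊥-elim)
open import Relation.Nullary using (¬_; ⌊_⌋; yes; no)
open import Relation.Binary.PropositionalEquality
open import Function.Definitions using (Injective)
open import Defs hiding (sym)
open import Defs using () renaming (sym to θ-sym)

_==_ : ∀ {n} → Fin n → Fin n → Bool
x == y = ⌊ x ≟ y ⌋

==-refl : ∀ {n} (x : Fin n) → (x == x) ≡ true
==-refl x with x ≟ x
... | yes _   = refl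
... | no x≢x = ⊥-elim (x≢x refl)

==-false : ∀ {n} {x y : Fin n} → x ≢ y → (x == y) ≡ false
==-false {x = x} {y} x≢y with x ≟ y
... | yes x≡y = ⊥-elim (x≢y x≡y)
... | no _    = refl

==-sym : ∀ {n} (x y : Fin n) → (x == y) ≡ (y == x)
==-sym x y with x ≟ y | y ≟ x
... | yes _   | yes _   = refl
... | no _    | no _    = refl
... | yes x≡y | no y≢x  = ⊥-elim (y≢x (sym x≡y))
... | no x≢y  | yes y≡x = ⊥-elim (x≢y (sym y≡x))

PairEq : ∀ {n} → Fin n → Fin n → Fin n → Fin n → Set
PairEq s t x y = (x ≡ s × y ≡ t) ⊎ (x ≡ t × y ≡ s)

-- The Boolean test of PairEq; `subdivide H u v` removes exactly the pairs
-- passing `samePair u v`.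
samePair : ∀ {n} → Fin n → Fin n → Fin n → Fin n → Bool
samePair s t x y = (x == s ∧ y == t) ∨ (x == t ∧ y == s)

samePair-sound : ∀ {n} {s t x y : Fin n} → samePair s t x y ≡ true → PairEq s t x y
samePair-sound {s = s} {t} {x} {y} e with x ≟ s | y ≟ t | x ≟ t | y ≟ s
... | yes x≡s | yes y≡t | _        | _        = inj₁ (x≡s , y≡t)
... | _       | _       | yes x≡t  | yes y≡s  = inj₂ (x≡t , y≡s)
samePair-sound () | no _  | _     | no _  | _
samePair-sound () | no _  | _     | yes _ | no _
samePair-sound () | yes _ | no _  | no _  | _
samePair-sound () | yes _ | no _  | yes _ | no _

samePair-complete : ∀ {n} {s t x y : Fin n} → PairEq s t x y → samePair s t x y ≡ true
samePair-complete {x = x} {y} (inj₁ (refl , refl)) rewrite ==-refl x | ==-refl y = refl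
samePair-complete {x = x} {y} (inj₂ (refl , refl)) rewrite ==-refl x | ==-refl y = ∨-zeroʳ _

samePair-false : ∀ {n} {s t x y : Fin n} → ¬ PairEq s t x y → samePair s t x y ≡ false
samePair-false {s = s} {t} {x} {y} ¬pair with samePair s t x y in e
... | false = refl
... | true  = ⊥-elim (¬pair (samePair-sound e))

samePair-sym : ∀ {n} (s t x y : Fin n) → samePair s t x y ≡ samePair s t y x
samePair-sym s t x y = begin
    (x == s ∧ y == t) ∨ (x == t ∧ y == s)
  ≡⟨ ∨-comm (x == s ∧ y == t) _ ⟩
    (x == t ∧ y == s) ∨ (x == s ∧ y == t)
  ≡⟨ cong₂ _∨_ (∧-comm (x == t) _) (∧-comm (x == s) _) ⟩
    (y == s ∧ x == t) ∨ (y == t ∧ x == s) ∎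
  where open ≡-Reasoning

record IsSimple {n} (S : Graph n) : Set where
  field
    loopless  : ∀ x → S x x ≡ false
    symmetric : ∀ x y → S x y ≡ S y x

-- S with the (virtual) edge st added.  The definition is kept opaque outside
-- the lemmas below, so that S, s and t can be inferred from `withEdge S s t`.
opaque
  withEdge : ∀ {n} → Graph n → Fin n → Fin n → Graph n
  withEdge S s t x y = S x y ∨ samePair s t x y

module _ {n} {S : Graph n} {s t : Fin n} where
  opaque
    unfolding withEdge

    withEdge-⊇ : ∀ {x y} → S x y ≡ true → withEdge S s t x y ≡ true
    withEdge-⊇ {x} {y} e = cong (_∨ samePair s t x y) e

    withEdge-pair : ∀ {x y} → PairEq s t x y → withEdge S s t x y ≡ true
    withEdge-pair {x} {y} p = trans (cong (S x y ∨_) (samePair-complete p)) (∨-zeroʳ (S x y))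

    withEdge-away : ∀ {x y} → ¬ PairEq s t x y → withEdge S s t x y ≡ S x y
    withEdge-away {x} {y} ¬p = trans (cong (S x y ∨_) (samePair-false ¬p)) (∨-identityʳ (S x y))

    withEdge-awayˡ : ∀ {x y} → x ≢ s → x ≢ t → withEdge S s t x y ≡ S x y
    withEdge-awayˡ x≢s x≢t = withEdge-away λ { (inj₁ (x≡s , _)) → x≢s x≡s
                                               ; (inj₂ (x≡t , _)) → x≢t x≡t }

    withEdge-avoid : ∀ {x y} → x ≢ t → y ≢ t → withEdge S s t x y ≡ S x y
    withEdge-avoid x≢t y≢t = withEdge-away λ { (inj₁ (_ , y≡t)) → y≢t y≡t
                                             ; (inj₂ (x≡t , _)) → x≢t x≡t }

    withEdge-redundant : IsSimple S → S s t ≡ true → ∀ x y → withEdge S s t x y ≡ S x y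
    withEdge-redundant simple st = redundant
      where
      redundant : ∀ x y → S x y ∨ samePair s t x y ≡ S x y
      redundant x y with samePair s t x y in e
      ... | false = ∨-identityʳ (S x y)
      ... | true with samePair-sound {s = s} {t} {x} {y} e
      ...   | inj₁ (refl , refl) rewrite st = refl
      ...   | inj₂ (refl , refl) rewrite IsSimple.symmetric simple t s | st = refl

    withEdge-simple : IsSimple S → s ≢ t → IsSimple (withEdge S s t)
    withEdge-simple simple s≢t = record
      { loopless  = λ x → trans (withEdge-away (not-loop x)) (IsSimple.loopless simple x)
      ; symmetric = λ x y → cong₂ _∨_ (IsSimple.symmetric simple x y) (samePair-sym s t x y) }
      where
      not-loop : ∀ x → ¬ PairEq s t x x
      not-loop x (inj₁ (x≡s , x≡t)) = s≢t (trans (sym x≡s) x≡t)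
      not-loop x (inj₂ (x≡t , x≡s)) = s≢t (trans (sym x≡s) x≡t)

InducedEmbedding : ∀ {m n} → Graph m → Graph n → (Fin m → Fin n) → Set
InducedEmbedding H S f = Injective _≡_ _≡_ f × (∀ i j → H i j ≡ S (f i) (f j))

Image : ∀ {m n} → (Fin m → Fin n) → Fin n → Set
Image f w = ∃ λ k → f k ≡ w

subdivide-embedding :
  ∀ {m n} {S : Graph n} {H : Graph m} {f : Fin m → Fin n} {u v : Fin m} {w : Fin n} →
  IsSimple S → InducedEmbedding H (withEdge S (f u) (f v)) f →
  (∀ k → f k ≢ w) → S w (f v) ≡ true → S (f u) (f v) ≡ false →
  (∀ k → k ≢ u → k ≢ v → S w (f k) ≡ false) →
  InducedEmbedding (subdivide H u v) (withEdge S (f u) w) (w ∷ f)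
subdivide-embedding {n = n} {S = S} {H} {f} {u} {v} {w} simple (f-inj , f-emb) fresh w~fv fu≁fv isolated =
  inj , emb
  where
  open IsSimple simple
  S′ : Graph n
  S′ = withEdge S (f u) w
  S′-simple : IsSimple S′
  S′-simple = withEdge-simple simple (λ fu≡w → fresh u fu≡w)

  inj : Injective _≡_ _≡_ (w ∷ f)
  inj {zero}  {zero}  _ = refl
  inj {zero}  {suc j} e = ⊥-elim (fresh j (sym e))
  inj {suc i} {zero}  e = ⊥-elim (fresh i e)
  inj {suc i} {suc j} e = cong suc (f-inj e)

  new-row : ∀ j → (⌊ j ≟ u ⌋ ∨ ⌊ j ≟ v ⌋) ≡ S′ w (f j)
  new-row j with j ≟ u
  ... | yes refl = sym (withEdge-pair (inj₂ (refl , refl)))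
  ... | no j≢u with j ≟ v
  ...   | yes refl = sym (withEdge-⊇ w~fv)
  ...   | no j≢v   = sym (trans (withEdge-away not-new) (isolated j j≢u j≢v))
    where
    not-new : ¬ PairEq (f u) w w (f j)
    not-new (inj₁ (w≡fu , _))  = fresh u (sym w≡fu)
    not-new (inj₂ (_ , fj≡fu)) = j≢u (f-inj fj≡fu)

  old-rows : ∀ i j → H i j ∧ not (samePair u v i j) ≡ S′ (f i) (f j)
  old-rows i j = trans (subdivided i j) (sym (withEdge-away not-new))
    where
    not-new : ¬ PairEq (f u) w (f i) (f j)
    not-new (inj₁ (_ , fj≡w)) = fresh j fj≡w
    not-new (inj₂ (fi≡w , _)) = fresh i fi≡w
    subdivided : ∀ i j → H i j ∧ not (samePair u v i j) ≡ S (f i) (f j)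
    subdivided i j with samePair u v i j in e
    ... | true with samePair-sound {s = u} {v} {i} {j} e
    ...   | inj₁ (refl , refl) = trans (∧-zeroʳ (H u v)) (sym fu≁fv)
    ...   | inj₂ (refl , refl) = trans (∧-zeroʳ (H v u)) (sym (trans (symmetric (f v) (f u)) fu≁fv))
    subdivided i j | false = trans (∧-identityʳ (H i j)) (trans (f-emb i j) (withEdge-away not-old))
      where
      not-old : ¬ PairEq (f u) (f v) (f i) (f j)
      not-old p with trans (sym e) (samePair-complete (⊎-map (λ (a , b) → f-inj a , f-inj b)
                                                            (λ (a , b) → f-inj a , f-inj b) p))
      ... | ()

  emb : ∀ i j → subdivide H u v i j ≡ S′ ((w ∷ f) i) ((w ∷ f) j)
  emb zero    zero    = sym (IsSimple.loopless S′-simple w)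
  emb zero    (suc j) = new-row j
  emb (suc i) zero    = trans (new-row i) (IsSimple.symmetric S′-simple w (f i))
  emb (suc i) (suc j) = old-rows i j

-- q 0, q 1, …, q (suc l) is an induced path of S.
record InducedPath {n} (S : Graph n) (q : ℕ → Fin n) (l : ℕ) : Set where
  field
    edge     : ∀ i → i ≤ l → S (q i) (q (suc i)) ≡ true
    no-chord : ∀ i j → j ≤ suc l → suc (suc i) ≤ j → S (q i) (q j) ≡ false
    distinct : ∀ i j → i ≤ suc l → j ≤ suc l → q i ≡ q j → i ≡ j

InducedPath-init : ∀ {n} {S : Graph n} {q l} → InducedPath S q (suc l) → InducedPath S q l
InducedPath-init path = record
  { edge     = λ i i≤l → edge i (m≤n⇒m≤1+n i≤l)
  ; no-chord = λ i j j≤ i<j → no-chord i j (m≤n⇒m≤1+n j≤) i<j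
  ; distinct = λ i j i≤ j≤ → distinct i j (m≤n⇒m≤1+n i≤) (m≤n⇒m≤1+n j≤) }
  where open InducedPath path

InducedPath-transfer : ∀ {n} {S S′ : Graph n} {q l} →
  (∀ i j → i ≤ suc l → j ≤ suc l → S′ (q i) (q j) ≡ S (q i) (q j)) →
  InducedPath S q l → InducedPath S′ q l
InducedPath-transfer {l = l} agree path = record
  { edge     = λ i i≤l → trans (agree i (suc i) (m≤n⇒m≤1+n i≤l) (s≤s i≤l)) (edge i i≤l)
  ; no-chord = λ i j j≤ i<j →
      trans (agree i j (≤-trans (≤-trans (n≤1+n i) (n≤1+n (suc i))) (≤-trans i<j j≤)) j≤)
            (no-chord i j j≤ i<j)
  ; distinct = distinct }
  where open InducedPath path

Interior : ∀ {n} → (ℕ → Fin n) → ℕ → Fin n → Set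
Interior q l w = ∃ λ i → 1 ≤ i × i ≤ l × q i ≡ w

record Detached {n} (S : Graph n) (U : Fin n → Set) (q : ℕ → Fin n) (l : ℕ) : Set where
  field
    outside  : ∀ i → 1 ≤ i → i ≤ l → ¬ U (q i)
    isolated : ∀ i → 1 ≤ i → i ≤ l → ∀ w → U w → w ≢ q 0 → w ≢ q (suc l) →
               S (q i) w ≡ false

Detached-init : ∀ {n} {S : Graph n} {U q l} → InducedPath S q (suc l) → Detached S U q (suc l) →
  Detached S (λ x → U x ⊎ x ≡ q (suc l)) q l
Detached-init {S = S} {U} {q} {l} path detached = record { outside = outside′ ; isolated = isolated′ }
  where
  open InducedPath path
  open Detached detached
  last-≢ : ∀ {i} → i ≤ l → q i ≢ q (suc l)
  last-≢ {i} i≤l e with distinct i (suc l) (m≤n⇒m≤1+n (m≤n⇒m≤1+n i≤l)) (n≤1+n (suc l)) e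
  ... | refl = 1+n≰n i≤l
  outside′ : ∀ i → 1 ≤ i → i ≤ l → ¬ (U (q i) ⊎ q i ≡ q (suc l))
  outside′ i 1≤i i≤l (inj₁ Uqi) = outside i 1≤i (m≤n⇒m≤1+n i≤l) Uqi
  outside′ i 1≤i i≤l (inj₂ e)   = last-≢ i≤l e
  isolated′ : ∀ i → 1 ≤ i → i ≤ l → ∀ w → U w ⊎ w ≡ q (suc l) → w ≢ q 0 → w ≢ q (suc l) →
              S (q i) w ≡ false
  isolated′ i 1≤i i≤l w (inj₂ w≡last) _ w≢last = ⊥-elim (w≢last w≡last)
  isolated′ i 1≤i i≤l w (inj₁ Uw) w≢first _ with w ≟ q (suc (suc l))
  ... | yes refl = no-chord i (suc (suc l)) ≤-refl (s≤s (s≤s i≤l))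
  ... | no w≢end = isolated i 1≤i (m≤n⇒m≤1+n i≤l) w Uw w≢first w≢end

-- The outcome of replacing the virtual edge q 0 — q (suc l) of an embedding
-- f : H → S + q 0 q (suc l) by the path q: a subdivision of H embedded in S,
-- using only vertices of U and of the interior of q, and all vertices of f.
record Replacement {m n} (S : Graph n) (U : Fin n → Set) (H : Graph m) (f : Fin m → Fin n)
                   (q : ℕ → Fin n) (l : ℕ) : Set where
  field
    size        : ℕ
    graph       : Graph size
    vertex      : Fin size → Fin n
    subdivision : SubdivK4 H → SubdivK4 graph
    embedding   : InducedEmbedding graph S vertex
    within      : ∀ k → U (vertex k) ⊎ Interior q l (vertex k)
    keeps       : ∀ {w} → Image f w → Image vertex w

-- By induction on the length: the virtual edge
-- q 0 — q (suc (suc l)) is subdivided by q (suc l) (`subdivide-embedding`),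
-- leaving the virtual edge q 0 — q (suc l) and a shorter path.
replace-edge-by-path :
  ∀ l {m n} {S : Graph n} {U : Fin n → Set} {q : ℕ → Fin n} {H : Graph m} {f : Fin m → Fin n} →
  IsSimple S → InducedPath S q l → Detached S U q l →
  InducedEmbedding H (withEdge S (q 0) (q (suc l))) f → (∀ k → U (f k)) →
  Image f (q 0) → Image f (q (suc l)) →
  Replacement S U H f q l
replace-edge-by-path zero simple path _ (f-inj , f-emb) f∈U _ _ = record
  { size = _ ; graph = _ ; vertex = _
  ; subdivision = λ h → h
  ; embedding   = f-inj , λ i j → trans (f-emb i j) (withEdge-redundant simple (edge 0 z≤n) _ _)
  ; within      = λ k → inj₁ (f∈U k)
  ; keeps       = λ h → h }
  where open InducedPath path
replace-edge-by-path (suc l) {n = n} {S = S} {U} {q} {H} {f} simple path detached emb f∈U (u , fu) (v , fv) =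
  record
  { size = size ; graph = graph ; vertex = vertex
  ; subdivision = λ h → subdivision (step h u v uv-edge)
  ; embedding   = embedding
  ; within      = λ k → shift (within k)
  ; keeps       = λ { (k , e) → keeps (suc k , e) } }
  where
  open InducedPath path
  open Detached detached
  w : Fin n
  w = q (suc l)
  emb-uv : InducedEmbedding H (withEdge S (f u) (f v)) f
  emb-uv = subst₂ (λ s t → InducedEmbedding H (withEdge S s t) f) (sym fu) (sym fv) emb
  uv-edge : H u v ≡ true
  uv-edge = trans (proj₂ emb-uv u v) (withEdge-pair (inj₁ (refl , refl)))
  w-fresh : ∀ k → f k ≢ w
  w-fresh k fk≡w = outside (suc l) (s≤s z≤n) ≤-refl (subst U fk≡w (f∈U k))
  w~fv : S w (f v) ≡ true
  w~fv = subst (λ t → S w t ≡ true) (sym fv) (edge (suc l) ≤-refl)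
  fu≁fv : S (f u) (f v) ≡ false
  fu≁fv = subst₂ (λ s t → S s t ≡ false) (sym fu) (sym fv)
                 (no-chord 0 (suc (suc l)) ≤-refl (s≤s (s≤s z≤n)))
  w-isolated : ∀ k → k ≢ u → k ≢ v → S w (f k) ≡ false
  w-isolated k k≢u k≢v =
    isolated (suc l) (s≤s z≤n) ≤-refl (f k) (f∈U k)
             (λ e → k≢u (proj₁ emb-uv (trans e (sym fu))))
             (λ e → k≢v (proj₁ emb-uv (trans e (sym fv))))
  emb₁ : InducedEmbedding (subdivide H u v) (withEdge S (q 0) w) (w ∷ f)
  emb₁ = subst (λ s → InducedEmbedding (subdivide H u v) (withEdge S s w) (w ∷ f)) fu
               (subdivide-embedding simple emb-uv w-fresh w~fv fu≁fv w-isolated)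
  f₁∈U₁ : ∀ k → U ((w ∷ f) k) ⊎ (w ∷ f) k ≡ w
  f₁∈U₁ zero    = inj₂ refl
  f₁∈U₁ (suc k) = inj₁ (f∈U k)
  open Replacement (replace-edge-by-path l simple (InducedPath-init path) (Detached-init path detached)
                                         emb₁ f₁∈U₁ (suc u , fu) (zero , refl))
  shift : ∀ {x} → (U x ⊎ x ≡ w) ⊎ Interior q l x → U x ⊎ Interior q (suc l) x
  shift (inj₁ (inj₁ Ux))              = inj₁ Ux
  shift (inj₁ (inj₂ refl))            = inj₂ (suc l , s≤s z≤n , ≤-refl , refl)
  shift (inj₂ (i , 1≤i , i≤l , qi≡x)) = inj₂ (i , 1≤i , m≤n⇒m≤1+n i≤l , qi≡x)

pattern #0 = zero
pattern #1 = suc zero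
pattern #2 = suc (suc zero)
pattern #3 = suc (suc (suc zero))

pairs-of-four : {Rel : Fin 4 → Fin 4 → Set} → (∀ {i j} → Rel i j → Rel j i) →
  Rel #0 #1 → Rel #0 #2 → Rel #0 #3 → Rel #1 #2 → Rel #1 #3 → Rel #2 #3 → ∀ i j → i ≢ j → Rel i j
pairs-of-four {Rel} sym′ r01 r02 r03 r12 r13 r23 = go
  where
  go : ∀ i j → i ≢ j → Rel i j
  go #0 #0 i≢j = ⊥-elim (i≢j refl)
  go #0 #1 _ = r01
  go #0 #2 _ = r02
  go #0 #3 _ = r03
  go #1 #0 _ = sym′ r01
  go #1 #1 i≢j = ⊥-elim (i≢j refl)
  go #1 #2 _ = r12
  go #1 #3 _ = r13
  go #2 #0 _ = sym′ r02
  go #2 #1 _ = sym′ r12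
  go #2 #2 i≢j = ⊥-elim (i≢j refl)
  go #2 #3 _ = r23
  go #3 #0 _ = sym′ r03
  go #3 #1 _ = sym′ r13
  go #3 #2 _ = sym′ r23
  go #3 #3 i≢j = ⊥-elim (i≢j refl)

Clique4 : ∀ {n} → Graph n → (Fin 4 → Fin n) → Set
Clique4 S v = ∀ i j → i ≢ j → (v i ≢ v j) × (S (v i) (v j) ≡ true)

K4-embedding : ∀ {n} {S : Graph n} {v : Fin 4 → Fin n} → IsSimple S → Clique4 S v →
  InducedEmbedding K4 S v
K4-embedding {S = S} {v} simple clique = inj , emb
  where
  inj : Injective _≡_ _≡_ v
  inj {i} {j} e with i ≟ j
  ... | yes i≡j = i≡j
  ... | no i≢j  = ⊥-elim (proj₁ (clique i j i≢j) e)
  emb : ∀ i j → K4 i j ≡ S (v i) (v j)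
  emb i j with i ≟ j
  ... | yes refl = sym (IsSimple.loopless simple (v i))
  ... | no i≢j   = sym (proj₂ (clique i j i≢j))

Adj-sym : ∀ {n} (G : Trigraph n) {u v} → Adj G u v → Adj G v u
Adj-sym G {u} {v} (u≢v , θ≢neg) = (λ e → u≢v (sym e)) , (λ e → θ≢neg (trans (θ-sym G u v) e))

Strong⇒Adj : ∀ {n} {G : Trigraph n} {u v} → Strong G u v → Adj G u v
Strong⇒Adj (u≢v , θ≡pos) = u≢v , λ θ≡neg → pos≢neg (trans (sym θ≡pos) θ≡neg)
  where
  pos≢neg : pos ≢ neg
  pos≢neg ()

Cons : ℕ → ℕ → Set
Cons i j = suc i ≡ j ⊎ suc j ≡ i

Cons-far : ∀ {i j} → suc (suc i) ≤ j → ¬ Cons i j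
Cons-far i+2≤j (inj₁ refl) = 1+n≰n i+2≤j
Cons-far i+2≤j (inj₂ refl) = 1+n≰n (≤-trans (n≤1+n _) (≤-trans (n≤1+n _) i+2≤j))

module _ {n} (G : Trigraph n) where

  record GPath (p : ℕ → Fin n) (k : ℕ) : Set where
    field
      distinct      : ∀ i j → i ≤ k → j ≤ k → p i ≡ p j → i ≡ j
      adjacent⇒cons : ∀ i j → i ≤ k → j ≤ k → Adj G (p i) (p j) → Cons i j
      consecutive   : ∀ i → suc i ≤ k → Adj G (p i) (p (suc i))

  record Joined (p : ℕ → Fin n) (k : ℕ) (q : ℕ → Fin n) (l : ℕ) : Set where
    field
      apart     : ∀ i j → i ≤ k → j ≤ l → p i ≢ q j
      only-ends : ∀ i j → i ≤ k → j ≤ l → Adj G (p i) (q j) → (i ≡ 0 × j ≡ 0) ⊎ (i ≡ k × j ≡ l)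
      start     : Adj G (p 0) (q 0)
      end       : Adj G (p k) (q l)

  Joined-sym : ∀ {p k q l} → Joined p k q l → Joined q l p k
  Joined-sym J = record
    { apart     = λ i j i≤ j≤ e → apart j i j≤ i≤ (sym e)
    ; only-ends = λ i j i≤ j≤ adj → ⊎-map swap swap (only-ends j i j≤ i≤ (Adj-sym G adj))
    ; start     = Adj-sym G start
    ; end       = Adj-sym G end }
    where open Joined J

  Joined-start : ∀ {p k q l} → Joined p (suc k) q l → ∀ j → 1 ≤ j → j ≤ l → ¬ Adj G (p 0) (q j)
  Joined-start J j 1≤j j≤l adj with Joined.only-ends J 0 j z≤n j≤l adj
  Joined-start J .0 () j≤l adj | inj₁ (_ , refl)
  ... | inj₂ (() , _)

_◂_ : ∀ {n} → Fin n → (ℕ → Fin n) → ℕ → Fin n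
(x ◂ p) zero    = x
(x ◂ p) (suc i) = p i

◂-avoids : ∀ {n} {x y : Fin n} {p k} → x ≢ y → (∀ i → i ≤ k → p i ≢ y) →
  ∀ i → i ≤ suc k → (x ◂ p) i ≢ y
◂-avoids x≢y p≢y zero    _         = x≢y
◂-avoids x≢y p≢y (suc i) (s≤s i≤k) = p≢y i i≤k

GPath-prepend : ∀ {n} {G : Trigraph n} {p k q l} → GPath G q l → Joined G p (suc k) q l →
  GPath G (p 0 ◂ q) (suc l)
GPath-prepend {n} {G} {p} {k} {q} {l} path J = record
  { distinct = distinct′ ; adjacent⇒cons = adjacent⇒cons′ ; consecutive = consecutive′ }
  where
  open GPath path
  open Joined J using (apart; start)
  x : Fin n
  x = p 0
  distinct′ : ∀ i j → i ≤ suc l → j ≤ suc l → (x ◂ q) i ≡ (x ◂ q) j → i ≡ j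
  distinct′ zero    zero    _         _         _ = refl
  distinct′ zero    (suc j) _         (s≤s j≤l) e = ⊥-elim (apart 0 j z≤n j≤l e)
  distinct′ (suc i) zero    (s≤s i≤l) _         e = ⊥-elim (apart 0 i z≤n i≤l (sym e))
  distinct′ (suc i) (suc j) (s≤s i≤l) (s≤s j≤l) e = cong suc (distinct i j i≤l j≤l e)
  x-adjacent : ∀ j → j ≤ l → Adj G x (q j) → j ≡ 0
  x-adjacent zero    _   _   = refl
  x-adjacent (suc j) j≤l adj = ⊥-elim (Joined-start G J (suc j) (s≤s z≤n) j≤l adj)
  adjacent⇒cons′ : ∀ i j → i ≤ suc l → j ≤ suc l → Adj G ((x ◂ q) i) ((x ◂ q) j) → Cons i j
  adjacent⇒cons′ zero    zero    _ _ adj = ⊥-elim (proj₁ adj refl)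
  adjacent⇒cons′ zero    (suc j) _ (s≤s j≤l) adj = inj₁ (cong suc (sym (x-adjacent j j≤l adj)))
  adjacent⇒cons′ (suc i) zero    (s≤s i≤l) _ adj =
    inj₂ (cong suc (sym (x-adjacent i i≤l (Adj-sym G adj))))
  adjacent⇒cons′ (suc i) (suc j) (s≤s i≤l) (s≤s j≤l) adj =
    ⊎-map (cong suc) (cong suc) (adjacent⇒cons i j i≤l j≤l adj)
  consecutive′ : ∀ i → suc i ≤ suc l → Adj G ((x ◂ q) i) ((x ◂ q) (suc i))
  consecutive′ zero    _           = start
  consecutive′ (suc i) (s≤s i+1≤l) = consecutive i i+1≤l

reverse : ∀ {n} → (ℕ → Fin n) → ℕ → ℕ → Fin n
reverse p k i = p (k ∸ i)

reverse-bottom : ∀ {i k} → i ≤ k → k ∸ i ≡ 0 → i ≡ k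
reverse-bottom i≤k e = ≤-antisym i≤k (m∸n≡0⇒m≤n e)

reverse-top : ∀ {i k} → i ≤ k → k ∸ i ≡ k → i ≡ 0
reverse-top i≤k e = ∸-cancelˡ-≡ i≤k z≤n e

reverse-step : ∀ {i k} → suc i ≤ k → suc (k ∸ suc i) ≡ k ∸ i
reverse-step {i} {suc k} (s≤s i≤k) = sym (+-∸-assoc 1 i≤k)

reverse-successor : ∀ {i j k} → i ≤ k → j ≤ k → suc (k ∸ i) ≡ k ∸ j → suc j ≡ i
reverse-successor {i} {j} {k} i≤k j≤k e = +-cancelˡ-≡ (k ∸ i) (suc j) i (begin
  (k ∸ i) + suc j   ≡⟨ +-suc (k ∸ i) j ⟩
  suc (k ∸ i) + j   ≡⟨ cong (_+ j) e ⟩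
  (k ∸ j) + j       ≡⟨ m∸n+n≡m j≤k ⟩
  k                 ≡⟨ sym (m∸n+n≡m i≤k) ⟩
  (k ∸ i) + i       ∎)
  where open ≡-Reasoning

reverse-cons : ∀ {i j k} → i ≤ k → j ≤ k → Cons (k ∸ i) (k ∸ j) → Cons i j
reverse-cons i≤k j≤k (inj₁ e) = inj₂ (reverse-successor i≤k j≤k e)
reverse-cons i≤k j≤k (inj₂ e) = inj₁ (reverse-successor j≤k i≤k e)

module _ {n} {G : Trigraph n} where

  GPath-reverse : ∀ {p k} → GPath G p k → GPath G (reverse p k) k
  GPath-reverse {p} {k} path = record
    { distinct      = λ i j i≤k j≤k e → ∸-cancelˡ-≡ i≤k j≤k (distinct _ _ (m∸n≤m k i) (m∸n≤m k j) e)
    ; adjacent⇒cons = λ i j i≤k j≤k adj →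
        reverse-cons i≤k j≤k (adjacent⇒cons _ _ (m∸n≤m k i) (m∸n≤m k j) adj)
    ; consecutive   = consecutive′ }
    where
    open GPath path
    consecutive′ : ∀ i → suc i ≤ k → Adj G (p (k ∸ i)) (p (k ∸ suc i))
    consecutive′ i i<k = Adj-sym G (subst (λ j → Adj G (p (k ∸ suc i)) (p j)) (reverse-step i<k)
      (consecutive (k ∸ suc i) (subst (_≤ k) (sym (reverse-step i<k)) (m∸n≤m k i))))

  Joined-reverse : ∀ {p k q l} → Joined G p k q l → Joined G (reverse p k) k (reverse q l) l
  Joined-reverse {p} {k} {q} {l} J = record
    { apart     = λ i j i≤k j≤l → apart _ _ (m∸n≤m k i) (m∸n≤m l j)
    ; only-ends = λ i j i≤k j≤l adj → swap-ends i≤k j≤l (only-ends _ _ (m∸n≤m k i) (m∸n≤m l j) adj)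
    ; start     = end
    ; end       = subst₂ (λ i j → Adj G (p i) (q j)) (sym (n∸n≡0 k)) (sym (n∸n≡0 l)) start }
    where
    open Joined J
    swap-ends : ∀ {i j} → i ≤ k → j ≤ l → (k ∸ i ≡ 0 × l ∸ j ≡ 0) ⊎ (k ∸ i ≡ k × l ∸ j ≡ l) →
                (i ≡ 0 × j ≡ 0) ⊎ (i ≡ k × j ≡ l)
    swap-ends i≤k j≤l (inj₁ (e , e′)) = inj₂ (reverse-bottom i≤k e , reverse-bottom j≤l e′)
    swap-ends i≤k j≤l (inj₂ (e , e′)) = inj₁ (reverse-top i≤k e , reverse-top j≤l e′)

-- A prism of G with the triangles only required to be adjacent (not
-- strongly): three paths P, Q, T of positive lengths a, b, c, pairwise joined
-- at both ends.  The triangles are P 0 Q 0 T 0 and P a Q b T c.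
record Frame {n} (G : Trigraph n) : Set where
  field
    a₀ b₀ c₀ : ℕ
    P Q T    : ℕ → Fin n
  a = 1 + a₀
  b = 1 + b₀
  c = 1 + c₀
  field
    P-path : GPath G P a
    Q-path : GPath G Q b
    T-path : GPath G T c
    PQ     : Joined G P a Q b
    PT     : Joined G P a T c
    QT     : Joined G Q b T c

-- The symmetries of frames used to bring any of the six triangle pairs to
-- the position P 0 Q 0.
module _ {n} {G : Trigraph n} where

  swap-frame : Frame G → Frame G
  swap-frame Fr = record
    { a₀ = a₀ ; b₀ = c₀ ; c₀ = b₀ ; P = P ; Q = T ; T = Q
    ; P-path = P-path ; Q-path = T-path ; T-path = Q-path
    ; PQ = PT ; PT = PQ ; QT = Joined-sym G QT }
    where open Frame Fr

  rotate-frame : Frame G → Frame G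
  rotate-frame Fr = record
    { a₀ = b₀ ; b₀ = c₀ ; c₀ = a₀ ; P = Q ; Q = T ; T = P
    ; P-path = Q-path ; Q-path = T-path ; T-path = P-path
    ; PQ = QT ; PT = Joined-sym G PQ ; QT = Joined-sym G PT }
    where open Frame Fr

  reverse-frame : Frame G → Frame G
  reverse-frame Fr = record
    { a₀ = a₀ ; b₀ = b₀ ; c₀ = c₀ ; P = reverse P a ; Q = reverse Q b ; T = reverse T c
    ; P-path = GPath-reverse P-path ; Q-path = GPath-reverse Q-path ; T-path = GPath-reverse T-path
    ; PQ = Joined-reverse PQ ; PT = Joined-reverse PT ; QT = Joined-reverse QT }
    where open Frame Fr

nonNeg : Sign → Bool
nonNeg neg = false
nonNeg zer = true
nonNeg pos = true

nonNeg-true : ∀ {σ} → σ ≢ neg → nonNeg σ ≡ true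
nonNeg-true {neg} σ≢neg = ⊥-elim (σ≢neg refl)
nonNeg-true {zer} _     = refl
nonNeg-true {pos} _     = refl

nonNeg-sound : ∀ {σ} → nonNeg σ ≡ true → σ ≢ neg
nonNeg-sound {neg} ()
nonNeg-sound {zer} _ ()
nonNeg-sound {pos} _ ()

module DropPair {n} (G : Trigraph n) (A B : Fin n) (AB-semi : θ G A B ≡ zer) where

  R : Graph n
  R u v = not (u == v) ∧ nonNeg (θ G u v) ∧ not (samePair A B u v)

  R-simple : IsSimple R
  R-simple = record { loopless = loopless ; symmetric = symmetric }
    where
    loopless : ∀ x → R x x ≡ false
    loopless x rewrite ==-refl x = refl
    symmetric : ∀ x y → R x y ≡ R y x
    symmetric x y rewrite ==-sym x y | θ-sym G x y | samePair-sym A B x y = refl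

  R-nonedge : ∀ {u v} → (Adj G u v → PairEq A B u v) → R u v ≡ false
  R-nonedge {u} {v} only-AB with u ≟ v
  ... | yes _ = refl
  ... | no u≢v with nonNeg (θ G u v) in e
  ...   | false = refl
  ...   | true rewrite samePair-complete (only-AB (u≢v , nonNeg-sound e)) = refl

  R-edge : ∀ {u v} → Adj G u v → ¬ PairEq A B u v → R u v ≡ true
  R-edge {u} {v} (u≢v , θ≢neg) ¬AB rewrite ==-false u≢v | nonNeg-true θ≢neg | samePair-false ¬AB = refl

  R-edge-avoiding : ∀ {u v} → Adj G u v → (u ≢ A × v ≢ A) ⊎ (u ≢ B × v ≢ B) → R u v ≡ true
  R-edge-avoiding adj avoid = R-edge adj (not-AB avoid)
    where
    not-AB : ∀ {u v} → (u ≢ A × v ≢ A) ⊎ (u ≢ B × v ≢ B) → ¬ PairEq A B u v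
    not-AB (inj₁ (u≢A , _)) (inj₁ (u≡A , _)) = u≢A u≡A
    not-AB (inj₁ (_ , v≢A)) (inj₂ (_ , v≡A)) = v≢A v≡A
    not-AB (inj₂ (_ , v≢B)) (inj₁ (_ , v≡B)) = v≢B v≡B
    not-AB (inj₂ (u≢B , _)) (inj₂ (u≡B , _)) = u≢B u≡B

  R-realization : IsRealization G R
  R-realization = IsSimple.loopless R-simple , IsSimple.symmetric R-simple ,
    λ u v u≢v → (λ θ≡pos → R-edge (Strong⇒Adj {G = G} (u≢v , θ≡pos)) (not-AB θ≡pos)) ,
                (λ θ≡neg → R-nonedge λ adj → ⊥-elim (proj₂ adj θ≡neg))
    where
    zer≢pos : zer ≢ pos
    zer≢pos ()
    not-AB : ∀ {u v} → θ G u v ≡ pos → ¬ PairEq A B u v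
    not-AB θ≡pos (inj₁ (refl , refl)) = zer≢pos (trans (sym AB-semi) θ≡pos)
    not-AB θ≡pos (inj₂ (refl , refl)) = zer≢pos (trans (sym AB-semi) (trans (θ-sym G A B) θ≡pos))

  GPath⇒InducedPath : ∀ {p l} → GPath G p (suc l) →
    (∀ i → i ≤ suc l → p i ≢ A) ⊎ (∀ i → i ≤ suc l → p i ≢ B) → InducedPath R p l
  GPath⇒InducedPath {p} {l} path avoid = record
    { edge     = λ i i≤l → R-edge-avoiding (consecutive i (s≤s i≤l)) (avoids (m≤n⇒m≤1+n i≤l) (s≤s i≤l))
    ; no-chord = λ i j j≤ i+2≤j → R-nonedge λ adj →
        ⊥-elim (Cons-far i+2≤j (adjacent⇒cons i j (earlier i+2≤j j≤) j≤ adj))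
    ; distinct = distinct }
    where
    open GPath path
    earlier : ∀ {i j} → suc (suc i) ≤ j → j ≤ suc l → i ≤ suc l
    earlier {i} i+2≤j j≤ = ≤-trans (≤-trans (n≤1+n i) (n≤1+n _)) (≤-trans i+2≤j j≤)
    avoids : ∀ {i j} → i ≤ suc l → j ≤ suc l → (p i ≢ A × p j ≢ A) ⊎ (p i ≢ B × p j ≢ B)
    avoids i≤ j≤ = ⊎-map (λ p≢A → p≢A _ i≤ , p≢A _ j≤) (λ p≢B → p≢B _ i≤ , p≢B _ j≤) avoid

Along : ∀ {n} → (ℕ → Fin n) → ℕ → Fin n → Set
Along p k w = ∃ λ i → i ≤ k × p i ≡ w

below-top : ∀ {i k} → i ≤ k → i ≢ suc k
below-top i≤k refl = 1+n≰n i≤k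

-- Otherwise let R be the realization in which P 0 Q 0 is the only dropped
-- adjacent pair, and put C = T 0, A′ = P a, B′ = Q b, C′ = T c.  These four
-- vertices form a K4 in R plus the virtual edges C A′, C B′, C C′; replacing
-- the virtual edges in turn by the paths T, C Q 0 … Q b and C P 0 … P a
-- yields an induced subdivision of K4 in R.
module BasePairNotSemi {n} (G : Trigraph n) (isk4-free : ISK4Free G) (Fr : Frame G)
                       (semi : θ G (Frame.P Fr 0) (Frame.Q Fr 0) ≡ zer) where
  open Frame Fr
  open DropPair G (P 0) (Q 0) semi
  open GPath P-path using () renaming (distinct to P-distinct)
  open GPath Q-path using () renaming (distinct to Q-distinct)
  open GPath T-path using () renaming (distinct to T-distinct)
  open Joined PQ using () renaming (apart to PQ-apart; only-ends to PQ-ends; end to PQ-end)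
  open Joined PT using () renaming (apart to PT-apart; only-ends to PT-ends; end to PT-end)
  open Joined QT using () renaming (apart to QT-apart; only-ends to QT-ends; end to QT-end)

  C A′ B′ C′ : Fin n
  C  = T 0
  A′ = P a
  B′ = Q b
  C′ = T c

  C≢A′ : C ≢ A′
  C≢A′ e = PT-apart a 0 ≤-refl z≤n (sym e)
  C≢B′ : C ≢ B′
  C≢B′ e = QT-apart b 0 ≤-refl z≤n (sym e)
  C≢C′ : C ≢ C′
  C≢C′ e = 0≢1+n (T-distinct 0 c z≤n ≤-refl e)

  S₁ S₂ S₃ : Graph n
  S₁ = withEdge R C A′
  S₂ = withEdge S₁ C B′
  S₃ = withEdge S₂ C C′

  S₁-simple : IsSimple S₁
  S₁-simple = withEdge-simple R-simple C≢A′
  S₂-simple : IsSimple S₂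
  S₂-simple = withEdge-simple S₁-simple C≢B′
  S₃-simple : IsSimple S₃
  S₃-simple = withEdge-simple S₂-simple C≢C′

  S₁-off : ∀ {x y} → x ≢ C → x ≢ A′ → S₁ x y ≡ R x y
  S₁-off = withEdge-awayˡ

  S₂-off : ∀ {x y} → x ≢ C → x ≢ A′ → x ≢ B′ → S₂ x y ≡ R x y
  S₂-off x≢C x≢A′ x≢B′ = trans (withEdge-awayˡ x≢C x≢B′) (S₁-off x≢C x≢A′)

  branch : Fin 4 → Fin n
  branch = C ∷ A′ ∷ B′ ∷ C′ ∷ []

  branch-clique : Clique4 S₃ branch
  branch-clique = pairs-of-four
    (λ (u≢v , uv) → (λ e → u≢v (sym e)) , trans (IsSimple.symmetric S₃-simple _ _) uv)
    (C≢A′ , withEdge-⊇ (withEdge-⊇ (withEdge-pair (inj₁ (refl , refl)))))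
    (C≢B′ , withEdge-⊇ (withEdge-pair (inj₁ (refl , refl))))
    (C≢C′ , withEdge-pair (inj₁ (refl , refl)))
    (PQ-apart a b ≤-refl ≤-refl , in-S₃ (R-edge-avoiding PQ-end (inj₁ (A′≢A , B′≢A))))
    (PT-apart a c ≤-refl ≤-refl , in-S₃ (R-edge-avoiding PT-end (inj₁ (A′≢A , C′≢A))))
    (QT-apart b c ≤-refl ≤-refl , in-S₃ (R-edge-avoiding QT-end (inj₁ (B′≢A , C′≢A))))
    where
    in-S₃ : ∀ {x y} → R x y ≡ true → S₃ x y ≡ true
    in-S₃ e = withEdge-⊇ (withEdge-⊇ (withEdge-⊇ e))
    A′≢A : A′ ≢ P 0
    A′≢A e = 0≢1+n (sym (P-distinct a 0 ≤-refl z≤n e))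
    B′≢A : B′ ≢ P 0
    B′≢A e = PQ-apart 0 b z≤n ≤-refl (sym e)
    C′≢A : C′ ≢ P 0
    C′≢A e = PT-apart 0 c z≤n ≤-refl (sym e)

  -- Stage 1: replace the virtual edge C C′ by the path T (inside S₂).
  T≢A′ : ∀ {i} → i ≤ c → T i ≢ A′
  T≢A′ i≤c e = PT-apart a _ ≤-refl i≤c (sym e)
  T≢B′ : ∀ {i} → i ≤ c → T i ≢ B′
  T≢B′ i≤c e = QT-apart b _ ≤-refl i≤c (sym e)

  T-induced : InducedPath S₂ T c₀
  T-induced = InducedPath-transfer agree
    (GPath⇒InducedPath T-path (inj₁ λ i i≤c e → PT-apart 0 i z≤n i≤c (sym e)))
    where
    agree : ∀ i j → i ≤ c → j ≤ c → S₂ (T i) (T j) ≡ R (T i) (T j)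
    agree i j i≤c j≤c = trans (withEdge-avoid (T≢B′ i≤c) (T≢B′ j≤c))
                              (withEdge-avoid (T≢A′ i≤c) (T≢A′ j≤c))

  T-detached : Detached S₂ (Image branch) T c₀
  T-detached = record { outside = outside ; isolated = isolated }
    where
    inner≢C : ∀ {i} → 1 ≤ i → i ≤ c → T i ≢ C
    inner≢C 1≤i i≤c e with T-distinct _ 0 i≤c z≤n e
    inner≢C () i≤c e | refl
    inner≢C′ : ∀ {i} → i ≤ c₀ → T i ≢ C′
    inner≢C′ i≤c₀ e = below-top i≤c₀ (T-distinct _ c (m≤n⇒m≤1+n i≤c₀) ≤-refl e)
    outside : ∀ i → 1 ≤ i → i ≤ c₀ → ¬ Image branch (T i)
    outside i 1≤i i≤c₀ (#0 , e) = inner≢C 1≤i (m≤n⇒m≤1+n i≤c₀) (sym e)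
    outside i 1≤i i≤c₀ (#1 , e) = T≢A′ (m≤n⇒m≤1+n i≤c₀) (sym e)
    outside i 1≤i i≤c₀ (#2 , e) = T≢B′ (m≤n⇒m≤1+n i≤c₀) (sym e)
    outside i 1≤i i≤c₀ (#3 , e) = inner≢C′ i≤c₀ (sym e)
    isolated : ∀ i → 1 ≤ i → i ≤ c₀ → ∀ w → Image branch w → w ≢ C → w ≢ C′ → S₂ (T i) w ≡ false
    isolated i 1≤i i≤c₀ _ (#0 , refl) w≢C _ = ⊥-elim (w≢C refl)
    isolated i 1≤i i≤c₀ _ (#3 , refl) _ w≢C′ = ⊥-elim (w≢C′ refl)
    isolated i 1≤i i≤c₀ _ (#1 , refl) _ _ =
      trans (S₂-off (inner≢C 1≤i i≤c) (T≢A′ i≤c) (T≢B′ i≤c)) (R-nonedge λ adj →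
        ⊥-elim (not-far-end (PT-ends a i ≤-refl i≤c (Adj-sym G adj))))
      where
      i≤c : i ≤ c
      i≤c = m≤n⇒m≤1+n i≤c₀
      not-far-end : (a ≡ 0 × i ≡ 0) ⊎ (a ≡ a × i ≡ c) → ⊥
      not-far-end (inj₂ (_ , i≡c)) = below-top i≤c₀ i≡c
    isolated i 1≤i i≤c₀ _ (#2 , refl) _ _ =
      trans (S₂-off (inner≢C 1≤i i≤c) (T≢A′ i≤c) (T≢B′ i≤c)) (R-nonedge λ adj →
        ⊥-elim (not-far-end (QT-ends b i ≤-refl i≤c (Adj-sym G adj))))
      where
      i≤c : i ≤ c
      i≤c = m≤n⇒m≤1+n i≤c₀
      not-far-end : (b ≡ 0 × i ≡ 0) ⊎ (b ≡ b × i ≡ c) → ⊥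
      not-far-end (inj₂ (_ , i≡c)) = below-top i≤c₀ i≡c

  stage₁ : Replacement S₂ (Image branch) K4 branch T c₀
  stage₁ = replace-edge-by-path c₀ S₂-simple T-induced T-detached
             (K4-embedding S₃-simple branch-clique) (λ k → k , refl) (#0 , refl) (#3 , refl)
  module Stage₁ = Replacement stage₁

  -- Stage 2: replace the virtual edge C B′ by the path C, Q 0, …, Q b (inside S₁).
  U₁ : Fin n → Set
  U₁ w = Along T c w ⊎ w ≡ A′ ⊎ w ≡ B′

  stage₁-within : ∀ {w} → Image branch w ⊎ Interior T c₀ w → U₁ w
  stage₁-within (inj₁ (#0 , refl))            = inj₁ (0 , z≤n , refl)
  stage₁-within (inj₁ (#1 , refl))            = inj₂ (inj₁ refl)
  stage₁-within (inj₁ (#2 , refl))            = inj₂ (inj₂ refl)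
  stage₁-within (inj₁ (#3 , refl))            = inj₁ (c , ≤-refl , refl)
  stage₁-within (inj₂ (i , _ , i≤c₀ , refl)) = inj₁ (i , m≤n⇒m≤1+n i≤c₀ , refl)

  CQ : ℕ → Fin n
  CQ = C ◂ Q

  CQ-induced : InducedPath S₁ CQ b
  CQ-induced = InducedPath-transfer agree
    (GPath⇒InducedPath (GPath-prepend Q-path (Joined-sym G QT))
      (inj₁ (◂-avoids (λ e → PT-apart 0 0 z≤n z≤n (sym e)) λ j j≤b e → PQ-apart 0 j z≤n j≤b (sym e))))
    where
    CQ≢A′ : ∀ i → i ≤ suc b → CQ i ≢ A′
    CQ≢A′ = ◂-avoids C≢A′ λ j j≤b e → PQ-apart a j ≤-refl j≤b (sym e)
    agree : ∀ i j → i ≤ suc b → j ≤ suc b → S₁ (CQ i) (CQ j) ≡ R (CQ i) (CQ j)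
    agree i j i≤ j≤ = withEdge-avoid (CQ≢A′ i i≤) (CQ≢A′ j j≤)

  CQ-detached : Detached S₁ U₁ CQ b
  CQ-detached = record { outside = outside ; isolated = isolated }
    where
    outside : ∀ i → 1 ≤ i → i ≤ b → ¬ U₁ (CQ i)
    outside (suc j) _ (s≤s j≤b₀) (inj₁ (k , k≤c , e)) = QT-apart j k (m≤n⇒m≤1+n j≤b₀) k≤c (sym e)
    outside (suc j) _ (s≤s j≤b₀) (inj₂ (inj₁ e)) = PQ-apart a j ≤-refl (m≤n⇒m≤1+n j≤b₀) (sym e)
    outside (suc j) _ (s≤s j≤b₀) (inj₂ (inj₂ e)) =
      below-top j≤b₀ (Q-distinct j b (m≤n⇒m≤1+n j≤b₀) ≤-refl e)
    isolated : ∀ i → 1 ≤ i → i ≤ b → ∀ w → U₁ w → w ≢ C → w ≢ B′ → S₁ (CQ i) w ≡ false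
    isolated (suc j) _ (s≤s j≤b₀) w U₁w w≢C w≢B′ =
      trans (S₁-off Qj≢C Qj≢A′) (R-nonedge λ adj → ⊥-elim (apart-from U₁w adj))
      where
      j≤b : j ≤ b
      j≤b = m≤n⇒m≤1+n j≤b₀
      Qj≢C : Q j ≢ C
      Qj≢C = QT-apart j 0 j≤b z≤n
      Qj≢A′ : Q j ≢ A′
      Qj≢A′ e = PQ-apart a j ≤-refl j≤b (sym e)
      apart-from : U₁ w → ¬ Adj G (Q j) w
      apart-from (inj₁ (k , k≤c , refl)) adj with QT-ends j k j≤b k≤c adj
      ... | inj₁ (_ , refl)   = w≢C refl
      ... | inj₂ (j≡b , _)    = below-top j≤b₀ j≡b
      apart-from (inj₂ (inj₁ refl)) adj with PQ-ends a j ≤-refl j≤b (Adj-sym G adj)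
      ... | inj₂ (_ , j≡b)    = below-top j≤b₀ j≡b
      apart-from (inj₂ (inj₂ refl)) _ = w≢B′ refl

  stage₂ : Replacement S₁ U₁ Stage₁.graph Stage₁.vertex CQ b
  stage₂ = replace-edge-by-path b S₁-simple CQ-induced CQ-detached Stage₁.embedding
             (λ k → stage₁-within (Stage₁.within k)) (Stage₁.keeps (#0 , refl)) (Stage₁.keeps (#2 , refl))
  module Stage₂ = Replacement stage₂

  -- Stage 3: replace the virtual edge C A′ by the path C, P 0, …, P a (inside R).
  U₂ : Fin n → Set
  U₂ w = Along T c w ⊎ Along Q b w ⊎ w ≡ A′

  stage₂-within : ∀ {w} → U₁ w ⊎ Interior CQ b w → U₂ w
  stage₂-within (inj₁ (inj₁ onT))                      = inj₁ onT
  stage₂-within (inj₁ (inj₂ (inj₁ w≡A′)))              = inj₂ (inj₂ w≡A′)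
  stage₂-within (inj₁ (inj₂ (inj₂ refl)))              = inj₂ (inj₁ (b , ≤-refl , refl))
  stage₂-within (inj₂ (suc j , _ , s≤s j≤b₀ , refl)) = inj₂ (inj₁ (j , m≤n⇒m≤1+n j≤b₀ , refl))

  CP : ℕ → Fin n
  CP = C ◂ P

  CP-induced : InducedPath R CP a
  CP-induced = GPath⇒InducedPath (GPath-prepend P-path (Joined-sym G PT))
    (inj₂ (◂-avoids (λ e → QT-apart 0 0 z≤n z≤n (sym e)) λ j j≤a → PQ-apart j 0 j≤a z≤n))

  CP-detached : Detached R U₂ CP a
  CP-detached = record { outside = outside ; isolated = isolated }
    where
    outside : ∀ i → 1 ≤ i → i ≤ a → ¬ U₂ (CP i)
    outside (suc j) _ (s≤s j≤a₀) (inj₁ (k , k≤c , e)) = PT-apart j k (m≤n⇒m≤1+n j≤a₀) k≤c (sym e)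
    outside (suc j) _ (s≤s j≤a₀) (inj₂ (inj₁ (k , k≤b , e))) = PQ-apart j k (m≤n⇒m≤1+n j≤a₀) k≤b (sym e)
    outside (suc j) _ (s≤s j≤a₀) (inj₂ (inj₂ e)) =
      below-top j≤a₀ (P-distinct j a (m≤n⇒m≤1+n j≤a₀) ≤-refl e)
    isolated : ∀ i → 1 ≤ i → i ≤ a → ∀ w → U₂ w → w ≢ C → w ≢ A′ → R (CP i) w ≡ false
    isolated (suc j) _ (s≤s j≤a₀) w U₂w w≢C w≢A′ = R-nonedge (only-base U₂w)
      where
      j≤a : j ≤ a
      j≤a = m≤n⇒m≤1+n j≤a₀
      -- the only possible adjacency is the dropped pair P 0 Q 0 itself
      only-base : U₂ w → Adj G (P j) w → PairEq (P 0) (Q 0) (P j) w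
      only-base (inj₁ (k , k≤c , refl)) adj with PT-ends j k j≤a k≤c adj
      ... | inj₁ (_ , refl) = ⊥-elim (w≢C refl)
      ... | inj₂ (j≡a , _)  = ⊥-elim (below-top j≤a₀ j≡a)
      only-base (inj₂ (inj₁ (k , k≤b , refl))) adj with PQ-ends j k j≤a k≤b adj
      ... | inj₁ (refl , refl) = inj₁ (refl , refl)
      ... | inj₂ (j≡a , _)     = ⊥-elim (below-top j≤a₀ j≡a)
      only-base (inj₂ (inj₂ refl)) _ = ⊥-elim (w≢A′ refl)

  stage₃ : Replacement R U₂ Stage₂.graph Stage₂.vertex CP a
  stage₃ = replace-edge-by-path a R-simple CP-induced CP-detached Stage₂.embedding
             (λ k → stage₂-within (Stage₂.within k))
             (Stage₂.keeps (Stage₁.keeps (#0 , refl))) (Stage₂.keeps (Stage₁.keeps (#1 , refl)))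
  module Stage₃ = Replacement stage₃

  contradiction : ⊥
  contradiction = isk4-free R R-realization Stage₃.graph
    (Stage₃.subdivision (Stage₂.subdivision (Stage₁.subdivision base)))
    (Stage₃.vertex , Stage₃.embedding)

base-pair-not-semi : ∀ {n} {G : Trigraph n} → ISK4Free G → (Fr : Frame G) →
  θ G (Frame.P Fr 0) (Frame.Q Fr 0) ≢ zer
base-pair-not-semi {G = G} isk4-free Fr semi = BasePairNotSemi.contradiction G isk4-free Fr semi

-- A path p : Fin (suc a) → X read as a sequence indexed by ℕ (constant beyond a).
extend : ∀ {X : Set} {a} → (Fin (suc a) → X) → ℕ → X
extend {a = zero}  p _       = p zero
extend {a = suc a} p zero    = p zero
extend {a = suc a} p (suc i) = extend (λ k → p (suc k)) i

extend-toℕ : ∀ {X : Set} {a} (p : Fin (suc a) → X) (k : Fin (suc a)) → extend p (toℕ k) ≡ p k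
extend-toℕ {a = zero}  p zero    = refl
extend-toℕ {a = suc a} p zero    = refl
extend-toℕ {a = suc a} p (suc k) = extend-toℕ (λ k → p (suc k)) k

extend-fromℕ : ∀ {X : Set} {a} (p : Fin (suc a) → X) → extend p a ≡ p (fromℕ a)
extend-fromℕ {a = a} p = trans (cong (extend p) (sym (toℕ-fromℕ a))) (extend-toℕ p (fromℕ a))

position : ∀ {a i} → i ≤ a → Σ (Fin (suc a)) λ k → toℕ k ≡ i
position i≤a = fromℕ< (s≤s i≤a) , toℕ-fromℕ< (s≤s i≤a)

module _ {n} {G : Trigraph n} where

  GPath-of-narrow : ∀ {a} {p : Fin (suc a) → Fin n} → NarrowPath G p → GPath G (extend p) a
  GPath-of-narrow {a} {p} (p-inj , p-adj) = record
    { distinct = distinct ; adjacent⇒cons = adjacent⇒cons ; consecutive = consecutive }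
    where
    distinct : ∀ i j → i ≤ a → j ≤ a → extend p i ≡ extend p j → i ≡ j
    distinct i j i≤a j≤a e with position i≤a | position j≤a
    ... | k , refl | k′ , refl =
      cong toℕ (p-inj (trans (sym (extend-toℕ p k)) (trans e (extend-toℕ p k′))))
    adjacent⇒cons : ∀ i j → i ≤ a → j ≤ a → Adj G (extend p i) (extend p j) → Cons i j
    adjacent⇒cons i j i≤a j≤a adj with position i≤a | position j≤a
    ... | k , refl | k′ , refl = proj₁ (p-adj k k′) (subst₂ (Adj G) (extend-toℕ p k) (extend-toℕ p k′) adj)
    consecutive : ∀ i → suc i ≤ a → Adj G (extend p i) (extend p (suc i))
    consecutive i i<a with position (≤-trans (n≤1+n i) i<a) | position i<a
    ... | k , refl | k′ , e = subst₂ (Adj G) (sym (extend-toℕ p k))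
      (sym (trans (cong (extend p) (sym e)) (extend-toℕ p k′))) (proj₂ (p-adj k k′) (inj₁ (sym e)))

  Joined-of-branches : ∀ {a b} {p : Fin (suc a) → Fin n} {q : Fin (suc b) → Fin n} →
    Disjoint p q → OnlyEnds G p q → Adj G (p zero) (q zero) → Adj G (p (fromℕ a)) (q (fromℕ b)) →
    Joined G (extend p) a (extend q) b
  Joined-of-branches {a} {b} {p} {q} disjoint only-ends start end = record
    { apart = apart ; only-ends = only-ends′
    ; start = subst₂ (Adj G) (sym (extend-toℕ p zero)) (sym (extend-toℕ q zero)) start
    ; end   = subst₂ (Adj G) (sym (extend-fromℕ p)) (sym (extend-fromℕ q)) end }
    where
    apart : ∀ i j → i ≤ a → j ≤ b → extend p i ≢ extend q j
    apart i j i≤a j≤b e with position i≤a | position j≤b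
    ... | k , refl | k′ , refl = disjoint k k′ (trans (sym (extend-toℕ p k)) (trans e (extend-toℕ q k′)))
    only-ends′ : ∀ i j → i ≤ a → j ≤ b → Adj G (extend p i) (extend q j) →
                 (i ≡ 0 × j ≡ 0) ⊎ (i ≡ a × j ≡ b)
    only-ends′ i j i≤a j≤b adj with position i≤a | position j≤b
    ... | k , refl | k′ , refl = only-ends k k′ (subst₂ (Adj G) (extend-toℕ p k) (extend-toℕ q k′) adj)

module _ {n} {G : Trigraph n} where

  Corners : Frame G → (x y z x′ y′ z′ : Fin n) → Set
  Corners Fr x y z x′ y′ z′ = (P 0 ≡ x × Q 0 ≡ y × T 0 ≡ z) × (P a ≡ x′ × Q b ≡ y′ × T c ≡ z′)
    where open Frame Fr

  frame-of-paths : ∀ {a b c} {px : Fin (suc a) → Fin n} {py : Fin (suc b) → Fin n} {pz : Fin (suc c) → Fin n} →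
    px zero ≢ px (fromℕ a) → py zero ≢ py (fromℕ b) → pz zero ≢ pz (fromℕ c) →
    GPath G (extend px) a → GPath G (extend py) b → GPath G (extend pz) c →
    Joined G (extend px) a (extend py) b → Joined G (extend px) a (extend pz) c →
    Joined G (extend py) b (extend pz) c →
    Σ (Frame G) λ Fr → Corners Fr (px zero) (py zero) (pz zero) (px (fromℕ a)) (py (fromℕ b)) (pz (fromℕ c))
  frame-of-paths {zero} x≢x′ _ _ _ _ _ _ _ _ = ⊥-elim (x≢x′ refl)
  frame-of-paths {suc _} {zero} _ y≢y′ _ _ _ _ _ _ _ = ⊥-elim (y≢y′ refl)
  frame-of-paths {suc _} {suc _} {zero} _ _ z≢z′ _ _ _ _ _ _ = ⊥-elim (z≢z′ refl)
  frame-of-paths {suc a₀} {suc b₀} {suc c₀} {px} {py} {pz} _ _ _ x-path y-path z-path xy xz yz =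
    record { a₀ = a₀ ; b₀ = b₀ ; c₀ = c₀ ; P = extend px ; Q = extend py ; T = extend pz
           ; P-path = x-path ; Q-path = y-path ; T-path = z-path ; PQ = xy ; PT = xz ; QT = yz } ,
    (refl , refl , refl) , (extend-fromℕ px , extend-fromℕ py , extend-fromℕ pz)

-- G and its full realization have the same adjacent pairs, so everything
-- phrased in terms of adjacency transfers from one to the other.
module FullRealization {n} (G : Trigraph n) where
  F : Trigraph n
  F = fullRealization G

  adj-from-full : ∀ {u v} → Adj F u v → Adj G u v
  adj-from-full (u≢v , ≢neg) = u≢v , λ θ≡neg → ≢neg (cong collapse θ≡neg)

  adj-to-full : ∀ {u v} → Adj G u v → Adj F u v
  adj-to-full {u} {v} (u≢v , ≢neg) = u≢v , λ e → ≢neg (collapse-neg e)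
    where
    collapse-neg : ∀ {σ} → collapse σ ≡ neg → σ ≡ neg
    collapse-neg {neg} _ = refl

  strong-from-full : ∀ {u v} → Strong F u v → θ G u v ≢ zer → Strong G u v
  strong-from-full {u} {v} (u≢v , e) not-semi with θ G u v
  ... | pos = u≢v , refl
  ... | zer = ⊥-elim (not-semi refl)

  narrow-from-full : ∀ {a} {p : Fin (suc a) → Fin n} → NarrowPath F p → NarrowPath G p
  narrow-from-full (p-inj , p-adj) = p-inj , λ i j →
    (λ adj → proj₁ (p-adj i j) (adj-to-full adj)) , (λ cons → adj-from-full (proj₂ (p-adj i j) cons))

  branch-transfer : ∀ (G′ G″ : Trigraph n) → (∀ {u v} → Adj G′ u v → Adj G″ u v) →
    ∀ {K v} → BranchIn G′ K v → BranchIn G″ K v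
  branch-transfer _ _ adj (u₁ , u₂ , u₃ , k₁ , k₂ , k₃ , d₁₂ , d₁₃ , d₂₃ , a₁ , a₂ , a₃) =
    u₁ , u₂ , u₃ , k₁ , k₂ , k₃ , d₁₂ , d₁₃ , d₂₃ , adj a₁ , adj a₂ , adj a₃

  flat-from-full : ∀ {a K} {p : Fin (suc a) → Fin n} → FlatBranch F K p → FlatBranch G K p
  flat-from-full (narrow , ends-differ , start-branch , end-branch , inner , flat) =
    narrow-from-full narrow , ends-differ ,
    branch-transfer F G adj-from-full start-branch , branch-transfer F G adj-from-full end-branch ,
    (λ i i≢0 i≢a br → inner i i≢0 i≢a (branch-transfer G F adj-to-full br)) ,
    (λ i j w Kw a₁ a₂ a₃ → flat i j w Kw (adj-to-full a₁) (adj-to-full a₂) (adj-to-full a₃))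

  only-ends-from-full : ∀ {a b} {p : Fin (suc a) → Fin n} {q : Fin (suc b) → Fin n} →
    OnlyEnds F p q → OnlyEnds G p q
  only-ends-from-full only-ends i j adj = only-ends i j (adj-to-full adj)

  frame-of-prism : (hp : HasPrism F) → Σ (Frame G) λ Fr →
    Corners Fr (HasPrism.x hp) (HasPrism.y hp) (HasPrism.z hp) (HasPrism.x' hp) (HasPrism.y' hp) (HasPrism.z' hp)
  frame-of-prism hp = frame-of-paths
    (proj₁ (proj₂ flat-x)) (proj₁ (proj₂ flat-y)) (proj₁ (proj₂ flat-z))
    (GPath-of-narrow (narrow-from-full (proj₁ flat-x)))
    (GPath-of-narrow (narrow-from-full (proj₁ flat-y)))
    (GPath-of-narrow (narrow-from-full (proj₁ flat-z)))
    (joined (proj₁ disjoint) ends-xy (proj₁ strong₁) (proj₁ strong₂))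
    (joined (proj₁ (proj₂ disjoint)) ends-xz (proj₂ (proj₂ strong₁)) (proj₂ (proj₂ strong₂)))
    (joined (proj₂ (proj₂ disjoint)) ends-yz (proj₁ (proj₂ strong₁)) (proj₁ (proj₂ strong₂)))
    where
    open HasPrism hp
    joined : ∀ {a b} {p : Fin (suc a) → Fin n} {q : Fin (suc b) → Fin n} →
      Disjoint p q → OnlyEnds F p q → Strong F (p zero) (q zero) → Strong F (p (fromℕ a)) (q (fromℕ b)) →
      Joined G (extend p) a (extend q) b
    joined disj ends start end = Joined-of-branches disj (only-ends-from-full ends)
      (adj-from-full (Strong⇒Adj {G = F} start)) (adj-from-full (Strong⇒Adj {G = F} end))

  -- In an ISK4-free G no pair of either triangle of the prism is semi-adjacent:
  -- each of the six pairs is the base pair P 0 Q 0 of a symmetric image of the frame.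
  triangles-not-semi : ISK4Free G → (hp : HasPrism F) → let open HasPrism hp in
    (θ G x y ≢ zer × θ G y z ≢ zer × θ G x z ≢ zer) ×
    (θ G x' y' ≢ zer × θ G y' z' ≢ zer × θ G x' z' ≢ zer)
  triangles-not-semi isk4-free hp with frame-of-prism hp
  ... | Fr , (P₀ , Q₀ , T₀) , (Pa , Qb , Tc) =
    ( at P₀ Q₀ (not-semi Fr) , at Q₀ T₀ (not-semi (rotate-frame Fr)) , at P₀ T₀ (not-semi (swap-frame Fr)) ) ,
    ( at Pa Qb (not-semi (reverse-frame Fr)) , at Qb Tc (not-semi (reverse-frame (rotate-frame Fr)))
    , at Pa Tc (not-semi (reverse-frame (swap-frame Fr))) )
    where
    not-semi : (Fr : Frame G) → θ G (Frame.P Fr 0) (Frame.Q Fr 0) ≢ zer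
    not-semi = base-pair-not-semi isk4-free
    at : ∀ {u v x y} → u ≡ x → v ≡ y → θ G u v ≢ zer → θ G x y ≢ zer
    at refl refl h = h

  strong-triangle : ∀ {x y z} → Strong F x y × Strong F y z × Strong F x z →
    θ G x y ≢ zer × θ G y z ≢ zer × θ G x z ≢ zer → Strong G x y × Strong G y z × Strong G x z
  strong-triangle (xy , yz , xz) (xy′ , yz′ , xz′) =
    strong-from-full xy xy′ , strong-from-full yz yz′ , strong-from-full xz xz′

proposition4p12 : ∀ {n} (G : Trigraph n) → ISK4Free G → WheelFree G →
    HasPrism (fullRealization G) → HasPrism G
proposition4p12 G isk4-free _ hp = record
  { a = a ; b = b ; c = c ; px = px ; py = py ; pz = pz
  ; triangles-disjoint = triangles-disjoint
  ; strong₁ = strong-triangle strong₁ (proj₁ (triangles-not-semi isk4-free hp))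
  ; strong₂ = strong-triangle strong₂ (proj₂ (triangles-not-semi isk4-free hp))
  ; disjoint = disjoint
  ; flat-x = flat-from-full flat-x ; flat-y = flat-from-full flat-y ; flat-z = flat-from-full flat-z
  ; ends-xy = only-ends-from-full ends-xy ; ends-xz = only-ends-from-full ends-xz
  ; ends-yz = only-ends-from-full ends-yz }
  where
  open HasPrism hp
  open FullRealization G
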